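{- Let $1\le q_1<q_2<\cdots$ be a strictly increasing sequence of integers satisfying $q_{n+1}<2q_n$ for all $n\ge 1$, and let $k_0\ge 0$ be a given integer. Let $S_n=q_1+\cdots+q_n$. Then $S_n-q_{n+1}\ge 2k_0$ for every integer $n\ge q_1+2k_0+1$. -}

module Defs where

open import Data.Nat using (ℕ; zero; suc; _+_)

S : (ℕ → ℕ) → ℕ → ℕ
S q zero    = 0
S q (suc n) = S q n + q (suc n)

-- Telescoping q (k + 2) < 2 q (k + 1), i.e. q (k + 2) − q (k + 1) ≤ q (k + 1) − 1, gives
-- q (n + 1) − q 1 ≤ S n − n, that is q (n + 1) + n ≤ S n + q 1. Once n ≥ q 1 + 2 k₀ this yields
-- the claim.
module Submission where

open import Defs
open import Data.Nat using (ℕ; zero; suc; _+_; _*_; _≤_; _<_; s≤s; z≤n)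
open import Data.Nat.Properties
open import Data.Nat.Tactic.RingSolver using (solve-∀)
open import Relation.Binary.PropositionalEquality using (_≡_; cong; subst)

q-suc+-≤-S+q₁ : (q : ℕ → ℕ) → (∀ n → 1 ≤ n → q (n + 1) < 2 * q n)
              → ∀ n → q (suc n) + n ≤ S q n + q 1
q-suc+-≤-S+q₁ q growth zero    = ≤-reflexive (+-identityʳ (q 1))
q-suc+-≤-S+q₁ q growth (suc n) = +-cancelˡ-≤ (q (suc n)) _ _ (begin
  q (suc n) + (q (suc (suc n)) + suc n)     ≡⟨ regroupˡ (q (suc n)) (q (suc (suc n))) n ⟩
  suc (q (suc (suc n))) + (q (suc n) + n)   ≤⟨ +-mono-≤ doubling (q-suc+-≤-S+q₁ q growth n) ⟩
  2 * q (suc n) + (S q n + q 1)             ≡⟨ regroupʳ (q (suc n)) (S q n) (q 1) ⟩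
  q (suc n) + (S q n + q (suc n) + q 1)     ∎)
  where
  open ≤-Reasoning
  doubling : q (suc (suc n)) < 2 * q (suc n)
  doubling = subst (λ m → q (suc m) < 2 * q (suc n)) (+-comm n 1) (growth (suc n) (s≤s z≤n))
  regroupˡ : ∀ a b m → a + (b + suc m) ≡ suc b + (a + m)
  regroupˡ = solve-∀
  regroupʳ : ∀ a s c → 2 * a + (s + c) ≡ a + (s + a + c)
  regroupʳ = solve-∀

lemma2p2 : (q : ℕ → ℕ) → 1 ≤ q 1
         → (∀ n → 1 ≤ n → q n < q (n + 1))
         → (∀ n → 1 ≤ n → q (n + 1) < 2 * q n)
         → (k₀ : ℕ) → ∀ n → q 1 + 2 * k₀ + 1 ≤ n
         → q (n + 1) + 2 * k₀ ≤ S q n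
lemma2p2 q _ _ growth k₀ n n-large = +-cancelʳ-≤ (q 1) _ _ (begin
  q (n + 1) + 2 * k₀ + q 1     ≡⟨ +-assoc (q (n + 1)) (2 * k₀) (q 1) ⟩
  q (n + 1) + (2 * k₀ + q 1)   ≤⟨ +-monoʳ-≤ (q (n + 1)) 2k₀+q₁≤n ⟩
  q (n + 1) + n                ≡⟨ cong (λ m → q m + n) (+-comm n 1) ⟩
  q (suc n) + n                ≤⟨ q-suc+-≤-S+q₁ q growth n ⟩
  S q n + q 1                  ∎)
  where
  open ≤-Reasoning
  2k₀+q₁≤n : 2 * k₀ + q 1 ≤ n
  2k₀+q₁≤n = begin
    2 * k₀ + q 1       ≡⟨ +-comm (2 * k₀) (q 1) ⟩
    q 1 + 2 * k₀       ≤⟨ m≤m+n (q 1 + 2 * k₀) 1 ⟩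
    q 1 + 2 * k₀ + 1   ≤⟨ n-large ⟩
    n                  ∎
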